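{- Let $G$ be a graph such that $V(G)\neq\emptyset$ and $IO(G)=\emptyset$. Then $G$ is indecomposable if and only if $L(G)=\emptyset$ and for any $x,y\in V(G)$ there exists a path from $x$ to $y$ in $G$.
   Context: $[n]=\{1,\dots,n\}$. A graph is a tuple $G=(V(G),E(G),I(G),O(G),IO(G),L(G),s,t,\alpha,\beta)$ where $V(G)$ (vertices), $E(G)$ (internal edges), $I(G)$ (input edges), $O(G)$ (output edges), $IO(G)$ (input-output edges), $L(G)$ (loops) are finite sets, $s:E(G)\sqcup O(G)\to V(G)$, $t:E(G)\sqcup I(G)\to V(G)$, $\alpha:I(G)\sqcup IO(G)\to[i(G)]$ a bijection with $i(G)=|I(G)|+|IO(G)|$, $\beta:O(G)\sqcup IO(G)\to[o(G)]$ a bijection with $o(G)=|O(G)|+|IO(G)|$. Graphs are considered up to isomorphism (bijections of the six sets compatible with $s,t,\alpha,\beta$). $\sigma\cdot G$ is $G$ with $\beta$ replaced by $\sigma\circ\beta$, $G\cdot\tau$ is $G$ with $\alpha$ replaced by $\tau^{ -1}\circ\alpha$. Horizontal concatenation $G*G'$: disjoint union of all six sets, with the input/output indices of $G'$ shifted by $i(G)$, resp. $o(G)$. Vertical concatenation $G'\circ G$ (for $o(G)=i(G')$): disjoint union of vertices and loops, each output (or input-output) edge $f$ of $G$ being glued to the input (or input-output) edge $e$ of $G'$ with $\beta(f)=\alpha'(e)$ (output-to-input gives an internal edge from $s(f)$ to $t'(e)$; input-output edges glued to inputs/outputs give input/output edges; input-output to input-output gives an input-output edge), with input indices from $G$ and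 output indices from $G'$. A graph $G$ is indecomposable if: (1) $V(G)\ne\emptyset$; (2) $IO(G)=\emptyset$; (3) $L(G)=\emptyset$ or $G$ is reduced to a single loop; (4) whenever $G=G'\circ G''$, then $V(G')=\emptyset$ or $V(G'')=\emptyset$; (5) whenever $G=\sigma\cdot(G'*G'')\cdot\tau$ for graphs $G',G''$ and permutations $\sigma,\tau$, then $V(G')=\emptyset$ or $V(G'')=\emptyset$. A path in $G$ from $x$ to $y$ is a sequence $(e_1,\dots,e_k)$ of internal edges with $t(e_i)=s(e_{i+1})$ for $i\in[k-1]$, $s(e_1)=x$, $t(e_k)=y$; by convention there is a unique path of length $0$ from any vertex to itself. -}

module Defs where

open import Level using (0ℓ)
open import Data.Nat using (ℕ; _+_)
open import Data.Fin using (Fin; _↑ˡ_; _↑ʳ_; cast)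
open import Data.Fin.Permutation using (Permutation′; _⟨$⟩ʳ_; _⟨$⟩ˡ_)
open import Data.Product using (Σ; _×_; _,_; proj₁; proj₂)
open import Data.Sum using (_⊎_; inj₁; inj₂)
import Data.Sum as Sum
open import Relation.Nullary using (¬_)
open import Relation.Binary.PropositionalEquality using (_≡_)
open import Function.Bundles using (_↔_; Inverse)
open import Function.Definitions using (Bijective)

Finite : Set → Set
Finite A = Σ ℕ (λ n → A ↔ Fin n)

Empty : Set → Set
Empty A = ¬ A

-- Pre-graphs: the data (V,E,I,O,IO,L,s,t,α,β) with i(G) = ni, o(G) = no
-- as indices; no finiteness/bijectivity requirement (those are added in
-- 'Graph').

record PreGraph (ni no : ℕ) : Set₁ where
  field
    V E I O IO L : Set
    s : E ⊎ O → V
    t : E ⊎ I → V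
    α : I ⊎ IO → Fin ni
    β : O ⊎ IO → Fin no

record Graph (ni no : ℕ) : Set₁ where
  field
    pre : PreGraph ni no
  open PreGraph pre public
  field
    finV  : Finite V
    finE  : Finite E
    finI  : Finite I
    finO  : Finite O
    finIO : Finite IO
    finL  : Finite L
    α-bij : Bijective _≡_ _≡_ α
    β-bij : Bijective _≡_ _≡_ β

open PreGraph

record Iso {ni no : ℕ} (G H : PreGraph ni no) : Set where
  field
    φV  : V G ↔ V H
    φE  : E G ↔ E H
    φI  : I G ↔ I H
    φO  : O G ↔ O H
    φIO : IO G ↔ IO H
    φL  : L G ↔ L H
    s-comm : ∀ x → Inverse.to φV (s G x)
                   ≡ s H (Sum.map (Inverse.to φE) (Inverse.to φO) x)
    t-comm : ∀ x → Inverse.to φV (t G x)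
                   ≡ t H (Sum.map (Inverse.to φE) (Inverse.to φI) x)
    α-comm : ∀ x → α H (Sum.map (Inverse.to φI) (Inverse.to φIO) x) ≡ α G x
    β-comm : ∀ x → β H (Sum.map (Inverse.to φO) (Inverse.to φIO) x) ≡ β G x

_·ˡ_ : ∀ {ni no} → Permutation′ no → PreGraph ni no → PreGraph ni no
σ ·ˡ G = record G { β = λ x → σ ⟨$⟩ʳ β G x }

_·ʳ_ : ∀ {ni no} → PreGraph ni no → Permutation′ ni → PreGraph ni no
G ·ʳ τ = record G { α = λ x → τ ⟨$⟩ˡ α G x }

castPG : ∀ {ni no ni' no'} → ni ≡ ni' → no ≡ no' → PreGraph ni no → PreGraph ni' no'
castPG p q G = record
  { V = V G ; E = E G ; I = I G ; O = O G ; IO = IO G ; L = L G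
  ; s = s G ; t = t G
  ; α = λ x → cast p (α G x) ; β = λ x → cast q (β G x) }

_*_ : ∀ {a b c d} → PreGraph a b → PreGraph c d → PreGraph (a + c) (b + d)
_*_ {a} {b} {c} {d} G H = record
  { V  = V G ⊎ V H
  ; E  = E G ⊎ E H
  ; I  = I G ⊎ I H
  ; O  = O G ⊎ O H
  ; IO = IO G ⊎ IO H
  ; L  = L G ⊎ L H
  ; s  = s*
  ; t  = t*
  ; α  = α*
  ; β  = β*
  }
  where
  s* : (E G ⊎ E H) ⊎ (O G ⊎ O H) → V G ⊎ V H
  s* (inj₁ (inj₁ e)) = inj₁ (s G (inj₁ e))
  s* (inj₁ (inj₂ e)) = inj₂ (s H (inj₁ e))
  s* (inj₂ (inj₁ o)) = inj₁ (s G (inj₂ o))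
  s* (inj₂ (inj₂ o)) = inj₂ (s H (inj₂ o))
  t* : (E G ⊎ E H) ⊎ (I G ⊎ I H) → V G ⊎ V H
  t* (inj₁ (inj₁ e)) = inj₁ (t G (inj₁ e))
  t* (inj₁ (inj₂ e)) = inj₂ (t H (inj₁ e))
  t* (inj₂ (inj₁ i)) = inj₁ (t G (inj₂ i))
  t* (inj₂ (inj₂ i)) = inj₂ (t H (inj₂ i))
  α* : (I G ⊎ I H) ⊎ (IO G ⊎ IO H) → Fin (a + c)
  α* (inj₁ (inj₁ i)) = α G (inj₁ i) ↑ˡ c
  α* (inj₁ (inj₂ i)) = a ↑ʳ α H (inj₁ i)
  α* (inj₂ (inj₁ x)) = α G (inj₂ x) ↑ˡ c
  α* (inj₂ (inj₂ x)) = a ↑ʳ α H (inj₂ x)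
  β* : (O G ⊎ O H) ⊎ (IO G ⊎ IO H) → Fin (b + d)
  β* (inj₁ (inj₁ o)) = β G (inj₁ o) ↑ˡ d
  β* (inj₁ (inj₂ o)) = b ↑ʳ β H (inj₁ o)
  β* (inj₂ (inj₁ x)) = β G (inj₂ x) ↑ˡ d
  β* (inj₂ (inj₂ x)) = b ↑ʳ β H (inj₂ x)

-- Vertical concatenation T ∘ B  (B below, T on top, o(B) = i(T) = k).
-- Output (or io) edge f of B is glued to input (or io) edge e of T
-- when β_B(f) = α_T(e).

module _ {a k b : ℕ} (T : PreGraph k b) (B : PreGraph a k) where
  -- output of B glued to input of T : internal edge
  GlueOI : Set
  GlueOI = Σ (O B × I T) (λ p → β B (inj₁ (proj₁ p)) ≡ α T (inj₁ (proj₂ p)))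
  -- io of B glued to input of T : input edge
  GlueXI : Set
  GlueXI = Σ (IO B × I T) (λ p → β B (inj₂ (proj₁ p)) ≡ α T (inj₁ (proj₂ p)))
  -- output of B glued to io of T : output edge
  GlueOX : Set
  GlueOX = Σ (O B × IO T) (λ p → β B (inj₁ (proj₁ p)) ≡ α T (inj₂ (proj₂ p)))
  -- io of B glued to io of T : io edge
  GlueXX : Set
  GlueXX = Σ (IO B × IO T) (λ p → β B (inj₂ (proj₁ p)) ≡ α T (inj₂ (proj₂ p)))

  private
    Vc Ec Ic Oc : Set
    Vc = V B ⊎ V T
    Ec = E B ⊎ (E T ⊎ GlueOI)
    Ic = I B ⊎ GlueXI
    Oc = O T ⊎ GlueOX

    sc : Ec ⊎ Oc → Vc
    sc (inj₁ (inj₁ e))        = inj₁ (s B (inj₁ e))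
    sc (inj₁ (inj₂ (inj₁ e))) = inj₂ (s T (inj₁ e))
    sc (inj₁ (inj₂ (inj₂ g))) = inj₁ (s B (inj₂ (proj₁ (proj₁ g))))
    sc (inj₂ (inj₁ o))        = inj₂ (s T (inj₂ o))
    sc (inj₂ (inj₂ g))        = inj₁ (s B (inj₂ (proj₁ (proj₁ g))))

    tc : Ec ⊎ Ic → Vc
    tc (inj₁ (inj₁ e))        = inj₁ (t B (inj₁ e))
    tc (inj₁ (inj₂ (inj₁ e))) = inj₂ (t T (inj₁ e))
    tc (inj₁ (inj₂ (inj₂ g))) = inj₂ (t T (inj₂ (proj₂ (proj₁ g))))
    tc (inj₂ (inj₁ i))        = inj₁ (t B (inj₂ i))
    tc (inj₂ (inj₂ g))        = inj₂ (t T (inj₂ (proj₂ (proj₁ g))))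

    αc : Ic ⊎ GlueXX → Fin a
    αc (inj₁ (inj₁ i)) = α B (inj₁ i)
    αc (inj₁ (inj₂ g)) = α B (inj₂ (proj₁ (proj₁ g)))
    αc (inj₂ g)        = α B (inj₂ (proj₁ (proj₁ g)))

    βc : Oc ⊎ GlueXX → Fin b
    βc (inj₁ (inj₁ o)) = β T (inj₁ o)
    βc (inj₁ (inj₂ g)) = β T (inj₂ (proj₂ (proj₁ g)))
    βc (inj₂ g)        = β T (inj₂ (proj₂ (proj₁ g)))

  _∘G_ : PreGraph a b
  _∘G_ = record
    { V = Vc ; E = Ec ; I = Ic ; O = Oc ; IO = GlueXX ; L = L B ⊎ L T
    ; s = sc ; t = tc ; α = αc ; β = βc }

SingleLoop : ∀ {ni no} → PreGraph ni no → Set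
SingleLoop G = Empty (V G) × Empty (E G) × Empty (I G) × Empty (O G)
             × Empty (IO G) × Σ (L G) (λ l → ∀ l' → l' ≡ l)

record Indecomposable {ni no : ℕ} (G : Graph ni no) : Set₁ where
  private module G = Graph G
  field
    nonempty : ¬ Empty G.V
    no-io    : Empty G.IO
    loops    : Empty G.L ⊎ SingleLoop G.pre
    vert     : ∀ {k} (G₁ : Graph k no) (G₂ : Graph ni k) →
               Iso G.pre (Graph.pre G₁ ∘G Graph.pre G₂) →
               Empty (Graph.V G₁) ⊎ Empty (Graph.V G₂)
    horiz    : ∀ {a b c d} (p : a + c ≡ ni) (q : b + d ≡ no)
               (G₁ : Graph a b) (G₂ : Graph c d)
               (σ : Permutation′ (b + d)) (τ : Permutation′ (a + c)) →
               Iso G.pre (castPG p q ((σ ·ˡ (Graph.pre G₁ * Graph.pre G₂)) ·ʳ τ)) →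
               Empty (Graph.V G₁) ⊎ Empty (Graph.V G₂)

data Path {ni no : ℕ} (G : PreGraph ni no) : V G → V G → Set where
  []  : ∀ {x} → Path G x x
  _∷_ : ∀ {x y} (e : E G) → s G (inj₁ e) ≡ x → Path G (t G (inj₁ e)) y → Path G x y

module Submission where

-- (⇐) Paths are transported along isomorphisms.  In a vertical composite
-- T ∘ B the vertices of T form a set closed under edges (edges never go
-- down), and in a horizontal composite G₁ * G₂ so do those of G₁.  In a
-- strongly connected graph no path leaves such a set, so one of the two
-- factors has no vertices.
--
-- (⇒) Saturating a set of explored vertices inside the finite vertex set
-- decides reachability: either x reaches y, or some edge-closed Boolean
-- colouring c has c x = true and c y = false.  In the latter case G ≅ T ∘ B,
-- where T ('Upper') is spanned by the true vertices and B ('Lower') by the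
-- false ones; the edges from B to T, the outputs of B and the inputs of T
-- form the interface between them.  Both factors are nonempty, which
-- contradicts indecomposability.

open import Defs
open import Level using (0ℓ)
open import Data.Nat using (ℕ; zero; suc; _+_; _∸_; _<_)
open import Data.Nat.Properties using (∸-monoʳ-<)
open import Data.Nat.Induction using (<-wellFounded)
open import Data.Bool using (Bool; true; false)
import Data.Bool.Properties as Bool
open import Data.Fin using (Fin)
open import Data.Fin.Permutation using (Permutation′)
open import Data.Fin.Properties using (+↔⊎; any?)
open import Data.Fin.Subset using (Subset; _∈_; _∉_; _⊂_; _∪_; ⁅_⁆; ∣_∣)
open import Data.Fin.Subset.Properties
  using (_∈?_; p⊂q⇒∣p∣<∣q∣; ∣p∣≤n; p⊆p∪q; x∈p∪q⁺; x∈p∪q⁻; x∈⁅x⁆; x∈⁅y⁆⇒x≡y)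
open import Data.Vec using (lookup)
open import Data.Vec.Properties using ([]=⇒lookup; lookup⇒[]=)
open import Data.Product using (Σ; ∃; _×_; _,_; proj₁; proj₂)
open import Data.Product.Function.Dependent.Propositional using (Σ-↔)
open import Data.Sum using (_⊎_; inj₁; inj₂; [_,_])
import Data.Sum as Sum
open import Data.Sum.Algebra using (⊎-assoc; ⊎-comm)
open import Data.Sum.Function.Propositional using (_⊎-↔_)
open import Data.Empty using (⊥; ⊥-elim)
open import Data.Unit using (⊤; tt)
open import Function using (_∘_; id; flip)
open import Function.Bundles using (_⇔_; mk⇔; _↔_; Inverse; mk↔ₛ′; Bijection)
open import Function.Definitions using (Bijective; Injective)
open import Function.Properties.Inverse using (↔-refl; ↔-sym; ↔-trans; Inverse⇒Bijection)
import Function.Construct.Composition as Composition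
open import Induction.WellFounded using (WellFounded; Acc; acc; module Subrelation)
import Relation.Binary.Construct.On as On
open import Relation.Nullary using (¬_; Dec; yes; no; Irrelevant; contradiction)
open import Relation.Nullary.Decidable using (_×-dec_; ¬?)
open import Relation.Binary.PropositionalEquality
  using (_≡_; refl; sym; trans; cong; cong₂; subst; subst₂)
open import Axiom.UniquenessOfIdentityProofs.WithK using (uip)

private
  variable
    A B C K L X Y : Set

empty↔ : ¬ A → ¬ B → A ↔ B
empty↔ ¬a ¬b = mk↔ₛ′ (⊥-elim ∘ ¬a) (⊥-elim ∘ ¬b) (⊥-elim ∘ ¬b) (⊥-elim ∘ ¬a)

⊎-emptyʳ : ¬ B → (A ⊎ B) ↔ A
⊎-emptyʳ ¬b = mk↔ₛ′ [ id , ⊥-elim ∘ ¬b ] inj₁ (λ _ → refl) [ (λ _ → refl) , ⊥-elim ∘ ¬b ]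

↔-bijective : (f : A ↔ B) → Bijective _≡_ _≡_ (Inverse.to f)
↔-bijective f = Bijection.bijective (Inverse⇒Bijection f)

bijective-∘↔ : {g : B → C} (f : A ↔ B) → Bijective _≡_ _≡_ g → Bijective _≡_ _≡_ (g ∘ Inverse.to f)
bijective-∘↔ f = Composition.bijective _≡_ _≡_ _≡_ (↔-bijective f)

Pullback : (X → K) → (Y → K) → Set
Pullback {X} {Y = Y} f g = Σ (X × Y) (λ xy → f (proj₁ xy) ≡ g (proj₂ xy))

-- Composing with an injective labelling does not change the pullback;
-- this is how the gluing of a vertical composite is computed.
glue-faithful : {code : K → L} → Injective _≡_ _≡_ code → (f : X → K) (g : Y → K) →
                Pullback (code ∘ f) (code ∘ g) ↔ Pullback f g
glue-faithful {code = code} code-inj f g =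
  mk↔ₛ′ (λ (xy , eq) → xy , code-inj eq) (λ (xy , eq) → xy , cong code eq)
        (λ (xy , _) → cong (xy ,_) (uip _ _)) (λ (xy , _) → cong (xy ,_) (uip _ _))

Finite-↔ : A ↔ B → Finite B → Finite A
Finite-↔ A↔B (n , B↔Fin) = n , ↔-trans A↔B B↔Fin

Finite-⊥ : Finite ⊥
Finite-⊥ = 0 , empty↔ (λ ()) (λ ())

Finite-⊎ : Finite A → Finite B → Finite (A ⊎ B)
Finite-⊎ (m , A↔Fin) (n , B↔Fin) = m + n , ↔-trans (A↔Fin ⊎-↔ B↔Fin) (↔-sym +↔⊎)

Finite-prop : Dec A → Irrelevant A → Finite A
Finite-prop (yes a) irr =
  1 , mk↔ₛ′ (λ _ → Fin.zero) (λ _ → a) (λ { Fin.zero → refl ; (Fin.suc ()) }) (irr a)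
Finite-prop (no ¬a) _   = 0 , empty↔ ¬a (λ ())

Σ-Fin-suc : ∀ {n} (Q : Fin (suc n) → Set) →
            Σ (Fin (suc n)) Q ↔ (Q Fin.zero ⊎ Σ (Fin n) (Q ∘ Fin.suc))
Σ-Fin-suc Q = mk↔ₛ′ to from (λ { (inj₁ _) → refl ; (inj₂ _) → refl })
                            (λ { (Fin.zero , _) → refl ; (Fin.suc _ , _) → refl })
  where
  to : Σ _ Q → Q Fin.zero ⊎ Σ _ (Q ∘ Fin.suc)
  to (Fin.zero , q)  = inj₁ q
  to (Fin.suc i , q) = inj₂ (i , q)
  from : Q Fin.zero ⊎ Σ _ (Q ∘ Fin.suc) → Σ _ Q
  from (inj₁ q)       = Fin.zero , q
  from (inj₂ (i , q)) = Fin.suc i , q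

Finite-ΣFin : ∀ {n} (Q : Fin n → Set) → (∀ i → Dec (Q i)) → (∀ i → Irrelevant (Q i)) →
              Finite (Σ (Fin n) Q)
Finite-ΣFin {zero}  Q Q? irr = 0 , empty↔ (λ { (() , _) }) (λ ())
Finite-ΣFin {suc n} Q Q? irr =
  Finite-↔ (Σ-Fin-suc Q) (Finite-⊎ (Finite-prop (Q? Fin.zero) (irr Fin.zero))
                                    (Finite-ΣFin (Q ∘ Fin.suc) (Q? ∘ Fin.suc) (irr ∘ Fin.suc)))

Finite-Σ : (P : A → Set) → Finite A → (∀ a → Dec (P a)) → (∀ a → Irrelevant (P a)) → Finite (Σ A P)
Finite-Σ {A = A} P (n , A↔Fin) P? irr =
  Finite-↔ (↔-sym (Σ-↔ (↔-sym A↔Fin) ↔-refl))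
           (Finite-ΣFin (P ∘ from) (P? ∘ from) (irr ∘ from))
  where
  from : Fin n → A
  from = Inverse.from A↔Fin

pick : Finite A → ¬ Empty A → A
pick (zero  , A↔Fin) nonempty = ⊥-elim (nonempty (λ a → case (Inverse.to A↔Fin a)))
  where case : Fin 0 → ⊥
        case ()
pick (suc n , A↔Fin) nonempty = Inverse.from A↔Fin Fin.zero

Fibre : (A → Bool) → Bool → Set
Fibre {A} f b = Σ A (λ a → f a ≡ b)

Finite-Fibre : Finite A → (f : A → Bool) (b : Bool) → Finite (Fibre f b)
Finite-Fibre finA f b = Finite-Σ (λ a → f a ≡ b) finA (λ a → f a Bool.≟ b) (λ _ → uip)

-- The map 'split' sends a
-- to the summand named by its colour; 'split-≡' computes it from any
-- proof of that colour, which is how every later computation uses it.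
module Split {A : Set} (f : A → Bool) where

  side : (b : Bool) → Fibre f b → Fibre f false ⊎ Fibre f true
  side false = inj₁
  side true  = inj₂

  split : A → Fibre f false ⊎ Fibre f true
  split a = side (f a) (a , refl)

  split-≡ : ∀ {a b} (p : f a ≡ b) → split a ≡ side b (a , p)
  split-≡ refl = refl

  split↔ : A ↔ (Fibre f false ⊎ Fibre f true)
  split↔ = mk↔ₛ′ split [ proj₁ , proj₁ ]
                 (λ { (inj₁ (_ , p)) → split-≡ p ; (inj₂ (_ , p)) → split-≡ p })
                 (λ a → forget-side (f a) (a , refl))
    where
    forget-side : ∀ b (x : Fibre f b) → [ proj₁ , proj₁ ] (side b x) ≡ proj₁ x
    forget-side false _ = refl
    forget-side true  _ = refl

module Split₂ {A : Set} (f g : A → Bool) (mono : ∀ a → f a ≡ true → g a ≡ true) where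

  Fibre₂ : Bool → Bool → Set
  Fibre₂ b₁ b₂ = Σ A (λ a → f a ≡ b₁ × g a ≡ b₂)

  Finite-Fibre₂ : Finite A → ∀ b₁ b₂ → Finite (Fibre₂ b₁ b₂)
  Finite-Fibre₂ finA b₁ b₂ =
    Finite-Σ _ finA (λ a → (f a Bool.≟ b₁) ×-dec (g a Bool.≟ b₂))
                    (λ _ (p , q) (p′ , q′) → cong₂ _,_ (uip p p′) (uip q q′))

  not-true-false : ∀ a → f a ≡ true → g a ≡ false → ⊥
  not-true-false a p q = contradiction (trans (sym (mono a p)) q) (λ ())

  Classes : Set
  Classes = Fibre₂ false false ⊎ (Fibre₂ true true ⊎ Fibre₂ false true)

  side₂ : ∀ b₁ b₂ → Fibre₂ b₁ b₂ → Classes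
  side₂ false false x             = inj₁ x
  side₂ true  true  x             = inj₂ (inj₁ x)
  side₂ false true  x             = inj₂ (inj₂ x)
  side₂ true  false (a , p , q)   = ⊥-elim (not-true-false a p q)

  split₂ : A → Classes
  split₂ a = side₂ (f a) (g a) (a , refl , refl)

  split₂-≡ : ∀ {a b₁ b₂} (p : f a ≡ b₁) (q : g a ≡ b₂) → split₂ a ≡ side₂ b₁ b₂ (a , p , q)
  split₂-≡ refl refl = refl

  split₂↔ : A ↔ Classes
  split₂↔ = mk↔ₛ′ split₂ forget
                  (λ { (inj₁ (_ , p , q)) → split₂-≡ p q ; (inj₂ (inj₁ (_ , p , q))) → split₂-≡ p q
                     ; (inj₂ (inj₂ (_ , p , q))) → split₂-≡ p q })
                  (λ a → forget-side (f a) (g a) (a , refl , refl))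
    where
    forget : Classes → A
    forget = [ proj₁ , [ proj₁ , proj₁ ] ]
    forget-side : ∀ b₁ b₂ (x : Fibre₂ b₁ b₂) → forget (side₂ b₁ b₂ x) ≡ proj₁ x
    forget-side false false _           = refl
    forget-side true  true  _           = refl
    forget-side false true  _           = refl
    forget-side true  false (a , p , q) = ⊥-elim (not-true-false a p q)

-- Strictly enlarging a subset of Fin n cannot go on forever, since its
-- size is bounded by n.
⊃-wellFounded : ∀ {n} → WellFounded (flip (_⊂_ {n}))
⊃-wellFounded {n} =
  Subrelation.wellFounded shrinks (On.wellFounded (λ p → n ∸ ∣ p ∣) <-wellFounded)
  where
  shrinks : ∀ {q p} → p ⊂ q → n ∸ ∣ q ∣ < n ∸ ∣ p ∣
  shrinks {q} p⊂q = ∸-monoʳ-< (p⊂q⇒∣p∣<∣q∣ p⊂q) (∣p∣≤n q)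

saturate : ∀ {n} (P Q : Subset n → Set) →
           (∀ p → P p → Q p ⊎ Σ (Subset n) (λ q → p ⊂ q × P q)) →
           ∀ p → P p → Σ (Subset n) (λ q → P q × Q q)
saturate P Q step p = go p (⊃-wellFounded p)
  where
  go : ∀ p → Acc (flip _⊂_) p → P p → Σ _ (λ q → P q × Q q)
  go p (acc smaller) Pp with step p Pp
  ... | inj₁ Qp             = p , Pp , Qp
  ... | inj₂ (q , p⊂q , Pq) = go q (smaller p⊂q) Pq

EdgeClosed : ∀ {ni no} (G : PreGraph ni no) → (PreGraph.V G → Set) → Set
EdgeClosed G P = ∀ e → P (PreGraph.s G (inj₁ e)) → P (PreGraph.t G (inj₁ e))

StronglyConnected : ∀ {ni no} → PreGraph ni no → Set
StronglyConnected G = ∀ x y → Path G x y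

module _ {ni no} {G : PreGraph ni no} where
  open PreGraph G

  _▷_ : ∀ {x y} → Path G x y → (e : E) → s (inj₁ e) ≡ y → Path G x (t (inj₁ e))
  ([] ▷ e) s≡y          = (e ∷ s≡y) []
  ((e′ ∷ eq) p ▷ e) s≡y = (e′ ∷ eq) ((p ▷ e) s≡y)

  path-preserves : (P : V → Set) → EdgeClosed G P → ∀ {x y} → Path G x y → P x → P y
  path-preserves P closed []             Px = Px
  path-preserves P closed ((e ∷ refl) p) Px = path-preserves P closed p (closed e Px)

module _ {ni no} {G H : PreGraph ni no} (φ : Iso G H) where
  open Iso φ

  Path-iso : ∀ {x y} → Path G x y → Path H (Inverse.to φV x) (Inverse.to φV y)
  Path-iso []           = []
  Path-iso ((e ∷ eq) p) =
    (Inverse.to φE e ∷ trans (sym (s-comm (inj₁ e))) (cong (Inverse.to φV) eq))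
      (subst (λ z → Path H z _) (t-comm (inj₁ e)) (Path-iso p))

  connected-iso : StronglyConnected G → StronglyConnected H
  connected-iso conn x y =
    subst₂ (Path H) (Inverse.strictlyInverseˡ φV x) (Inverse.strictlyInverseˡ φV y)
      (Path-iso (conn (Inverse.from φV x) (Inverse.from φV y)))

∉⇒lookup≡false : ∀ {n i} (p : Subset n) → i ∉ p → lookup p i ≡ false
∉⇒lookup≡false {i = i} p i∉p with lookup p i in eq
... | true  = ⊥-elim (i∉p (lookup⇒[]= i p eq))
... | false = refl

data Reachability {ni no} (G : PreGraph ni no) (x y : PreGraph.V G) : Set where
  reachable : Path G x y → Reachability G x y
  separated : (c : PreGraph.V G → Bool) → EdgeClosed G (λ v → c v ≡ true) →
              c x ≡ true → c y ≡ false → Reachability G x y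

-- The dichotomy is decided by saturating, inside the vertex set encoded
-- as Fin nV, a set of vertices all reachable from x, adding the target of
-- some edge that leaves it until no edge leaves it.
module Explore {n₁ n₂} (G : PreGraph n₁ n₂)
               (finV : Finite (PreGraph.V G)) (finE : Finite (PreGraph.E G)) (x : PreGraph.V G) where
  open PreGraph G

  nV : ℕ
  nV = proj₁ finV
  enc : V → Fin nV
  enc = Inverse.to (proj₂ finV)
  dec : Fin nV → V
  dec = Inverse.from (proj₂ finV)
  edge : Fin (proj₁ finE) → E
  edge = Inverse.from (proj₂ finE)

  sE tE : E → V
  sE e = s (inj₁ e)
  tE e = t (inj₁ e)

  Explored : Subset nV → Set
  Explored p = enc x ∈ p × (∀ i → i ∈ p → Path G x (dec i))

  Saturated : Subset nV → Set
  Saturated p = ∀ e → enc (sE e) ∈ p → enc (tE e) ∈ p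

  toward-dec : ∀ {v} → Path G x v → Path G x (dec (enc v))
  toward-dec {v} = subst (Path G x) (sym (Inverse.strictlyInverseʳ (proj₂ finV) v))

  reach-member : ∀ {p} → Explored p → ∀ v → enc v ∈ p → Path G x v
  reach-member (_ , paths) v v∈p =
    subst (Path G x) (Inverse.strictlyInverseʳ (proj₂ finV) v) (paths (enc v) v∈p)

  start : Explored ⁅ enc x ⁆
  start = x∈⁅x⁆ (enc x) ,
          λ i i∈ → subst (Path G x ∘ dec) (sym (x∈⁅y⁆⇒x≡y (enc x) i∈)) (toward-dec [])

  extend : ∀ {p} e → Explored p → enc (sE e) ∈ p → enc (tE e) ∉ p →
           Σ (Subset nV) (λ q → p ⊂ q × Explored q)
  extend {p} e explored@(x∈p , paths) s∈p t∉p =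
    q , (p⊆p∪q _ , enc (tE e) , x∈p∪q⁺ (inj₂ (x∈⁅x⁆ _)) , t∉p) , (p⊆p∪q _ x∈p , paths′)
    where
    q : Subset nV
    q = p ∪ ⁅ enc (tE e) ⁆
    paths′ : ∀ i → i ∈ q → Path G x (dec i)
    paths′ i i∈q with x∈p∪q⁻ p _ i∈q
    ... | inj₁ i∈p    = paths i i∈p
    ... | inj₂ i∈⁅t⁆ rewrite x∈⁅y⁆⇒x≡y _ i∈⁅t⁆ =
      toward-dec ((reach-member explored (sE e) s∈p ▷ e) refl)

  Leaving : Subset nV → Fin (proj₁ finE) → Set
  Leaving p j = enc (sE (edge j)) ∈ p × enc (tE (edge j)) ∉ p

  saturated : ∀ p → ¬ ∃ (Leaving p) → Saturated p
  saturated p none e s∈p with enc (tE e) ∈? p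
  ... | yes t∈p = t∈p
  ... | no  t∉p = ⊥-elim (none (Inverse.to (proj₂ finE) e ,
                    subst (λ e′ → enc (sE e′) ∈ p × enc (tE e′) ∉ p)
                          (sym (Inverse.strictlyInverseʳ (proj₂ finE) e)) (s∈p , t∉p)))

  step : ∀ p → Explored p → Saturated p ⊎ Σ (Subset nV) (λ q → p ⊂ q × Explored q)
  step p explored with any? (λ j → (enc (sE (edge j)) ∈? p) ×-dec ¬? (enc (tE (edge j)) ∈? p))
  ... | yes (j , s∈p , t∉p) = inj₂ (extend (edge j) explored s∈p t∉p)
  ... | no  none            = inj₁ (saturated p none)

  decide : ∀ y → Reachability G x y
  decide y with saturate Explored Saturated step ⁅ enc x ⁆ start
  ... | q , explored@(x∈q , _) , sat with enc y ∈? q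
  ...   | yes y∈q = reachable (reach-member explored y y∈q)
  ...   | no  y∉q = separated (λ v → lookup q (enc v))
                              (λ e s∈q → []=⇒lookup (sat e (lookup⇒[]= _ q s∈q)))
                              ([]=⇒lookup x∈q) (∉⇒lookup≡false q y∉q)

reachability : ∀ {ni no} (G : PreGraph ni no) → Finite (PreGraph.V G) → Finite (PreGraph.E G) →
               ∀ x y → Reachability G x y
reachability G finV finE x = Explore.decide G finV finE x

-- All
-- compatibilities hold definitionally once the colours are known.
module Decomposition {n₁ n₂} (G : Graph n₁ n₂)
                     (no-io : Empty (Graph.IO G)) (no-loops : Empty (Graph.L G))
                     (c : Graph.V G → Bool) (closed : EdgeClosed (Graph.pre G) (λ v → c v ≡ true))
                     where
  open Graph G using (pre; V; E; I; O; IO; s; t; α; β; finV; finE; finI; finO; α-bij; β-bij)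

  sE tE : E → V
  sE e = s (inj₁ e)
  tE e = t (inj₁ e)
  tI : I → V
  tI i = t (inj₂ i)
  sO : O → V
  sO o = s (inj₂ o)

  module SV = Split c
  module SE = Split₂ (c ∘ sE) (c ∘ tE) closed
  module SI = Split (c ∘ tI)
  module SO = Split (c ∘ sO)

  Vᴮ Vᵀ Eᴮ Eᵀ Cross Iᴮ Iᵀ Oᴮ Oᵀ : Set
  Vᴮ    = Fibre c false
  Vᵀ    = Fibre c true
  Eᴮ    = SE.Fibre₂ false false
  Eᵀ    = SE.Fibre₂ true true
  Cross = SE.Fibre₂ false true
  Iᴮ    = Fibre (c ∘ tI) false
  Iᵀ    = Fibre (c ∘ tI) true
  Oᴮ    = Fibre (c ∘ sO) false
  Oᵀ    = Fibre (c ∘ sO) true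

  -- The interface between Lower and Upper: the crossing edges, the outputs
  -- of G leaving Lower (which pass through Upper as input-output edges)
  -- and the inputs of G entering Upper (which pass through Lower).
  Interface : Set
  Interface = Cross ⊎ (Oᴮ ⊎ Iᵀ)

  finite-interface : Finite Interface
  finite-interface = Finite-⊎ (SE.Finite-Fibre₂ finE false true)
                              (Finite-⊎ (Finite-Fibre finO (c ∘ sO) false)
                                        (Finite-Fibre finI (c ∘ tI) true))

  k : ℕ
  k = proj₁ finite-interface

  code : Interface ↔ Fin k
  code = proj₂ finite-interface

  code-injective : Injective _≡_ _≡_ (Inverse.to code)
  code-injective = proj₁ (↔-bijective code)

  lower-ports : ((Cross ⊎ Oᴮ) ⊎ Iᵀ) ↔ Interface
  lower-ports = ⊎-assoc 0ℓ _ _ _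

  upper-ports : ((Cross ⊎ Iᵀ) ⊎ Oᴮ) ↔ Interface
  upper-ports = ↔-trans (⊎-assoc 0ℓ _ _ _) (↔-refl ⊎-↔ ⊎-comm _ _)

  lower-port : (Cross ⊎ Oᴮ) ⊎ Iᵀ → Interface
  lower-port = Inverse.to lower-ports

  upper-port : (Cross ⊎ Iᵀ) ⊎ Oᴮ → Interface
  upper-port = Inverse.to upper-ports

  lower-inputs : (Iᴮ ⊎ Iᵀ) ↔ (I ⊎ IO)
  lower-inputs = ↔-trans (↔-sym SI.split↔) (↔-sym (⊎-emptyʳ no-io))

  upper-outputs : (Oᵀ ⊎ Oᴮ) ↔ (O ⊎ IO)
  upper-outputs = ↔-trans (⊎-comm _ _) (↔-trans (↔-sym SO.split↔) (↔-sym (⊎-emptyʳ no-io)))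

  sᴮ : Eᴮ ⊎ (Cross ⊎ Oᴮ) → Vᴮ
  sᴮ (inj₁ (e , p , _))        = sE e , p
  sᴮ (inj₂ (inj₁ (e , p , _))) = sE e , p
  sᴮ (inj₂ (inj₂ (o , p)))     = sO o , p

  tᴮ : Eᴮ ⊎ Iᴮ → Vᴮ
  tᴮ (inj₁ (e , _ , q)) = tE e , q
  tᴮ (inj₂ (i , p))     = tI i , p

  Lower : PreGraph n₁ k
  Lower = record { V = Vᴮ ; E = Eᴮ ; I = Iᴮ ; O = Cross ⊎ Oᴮ ; IO = Iᵀ ; L = ⊥ ; s = sᴮ ; t = tᴮ
                 ; α = α ∘ Inverse.to lower-inputs ; β = Inverse.to (↔-trans lower-ports code) }

  sᵀ : Eᵀ ⊎ Oᵀ → Vᵀ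
  sᵀ (inj₁ (e , p , _)) = sE e , p
  sᵀ (inj₂ (o , p))     = sO o , p

  tᵀ : Eᵀ ⊎ (Cross ⊎ Iᵀ) → Vᵀ
  tᵀ (inj₁ (e , _ , q))        = tE e , q
  tᵀ (inj₂ (inj₁ (e , _ , q))) = tE e , q
  tᵀ (inj₂ (inj₂ (i , p)))     = tI i , p

  Upper : PreGraph k n₂
  Upper = record { V = Vᵀ ; E = Eᵀ ; I = Cross ⊎ Iᵀ ; O = Oᵀ ; IO = Oᴮ ; L = ⊥ ; s = sᵀ ; t = tᵀ
                 ; α = Inverse.to (↔-trans upper-ports code) ; β = β ∘ Inverse.to upper-outputs }

  Lower-graph : Graph n₁ k
  Lower-graph = record
    { pre = Lower ; finV = Finite-Fibre finV c false ; finE = SE.Finite-Fibre₂ finE false false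
    ; finI = Finite-Fibre finI (c ∘ tI) false
    ; finO = Finite-⊎ (SE.Finite-Fibre₂ finE false true) (Finite-Fibre finO (c ∘ sO) false)
    ; finIO = Finite-Fibre finI (c ∘ tI) true ; finL = Finite-⊥
    ; α-bij = bijective-∘↔ lower-inputs α-bij ; β-bij = ↔-bijective (↔-trans lower-ports code) }

  Upper-graph : Graph k n₂
  Upper-graph = record
    { pre = Upper ; finV = Finite-Fibre finV c true ; finE = SE.Finite-Fibre₂ finE true true
    ; finI = Finite-⊎ (SE.Finite-Fibre₂ finE false true) (Finite-Fibre finI (c ∘ tI) true)
    ; finO = Finite-Fibre finO (c ∘ sO) true
    ; finIO = Finite-Fibre finO (c ∘ sO) false ; finL = Finite-⊥
    ; α-bij = ↔-bijective (↔-trans upper-ports code) ; β-bij = bijective-∘↔ upper-outputs β-bij }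

  glue-cross : Cross ↔ GlueOI Upper Lower
  glue-cross = ↔-sym (↔-trans (glue-faithful code-injective _ _) pullback)
    where
    to : Pullback (lower-port ∘ inj₁) (upper-port ∘ inj₁) → Cross
    to ((inj₁ x , inj₁ _) , refl) = x
    to ((inj₁ _ , inj₂ _) , ())
    to ((inj₂ _ , inj₁ _) , ())
    to ((inj₂ _ , inj₂ _) , ())
    pullback : Pullback (lower-port ∘ inj₁) (upper-port ∘ inj₁) ↔ Cross
    pullback = mk↔ₛ′ to (λ x → (inj₁ x , inj₁ x) , refl) (λ _ → refl)
                     λ { ((inj₁ _ , inj₁ _) , refl) → refl ; ((inj₁ _ , inj₂ _) , ())
                       ; ((inj₂ _ , inj₁ _) , ()) ; ((inj₂ _ , inj₂ _) , ()) }

  glue-input : Iᵀ ↔ GlueXI Upper Lower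
  glue-input = ↔-sym (↔-trans (glue-faithful code-injective _ _) pullback)
    where
    to : Pullback (lower-port ∘ inj₂) (upper-port ∘ inj₁) → Iᵀ
    to ((x , inj₂ _) , refl) = x
    to ((_ , inj₁ _) , ())
    pullback : Pullback (lower-port ∘ inj₂) (upper-port ∘ inj₁) ↔ Iᵀ
    pullback = mk↔ₛ′ to (λ x → (x , inj₂ x) , refl) (λ _ → refl)
                     λ { ((_ , inj₂ _) , refl) → refl ; ((_ , inj₁ _) , ()) }

  glue-output : Oᴮ ↔ GlueOX Upper Lower
  glue-output = ↔-sym (↔-trans (glue-faithful code-injective _ _) pullback)
    where
    to : Pullback (lower-port ∘ inj₁) (upper-port ∘ inj₂) → Oᴮ
    to ((inj₂ x , _) , refl) = x
    to ((inj₁ _ , _) , ())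
    pullback : Pullback (lower-port ∘ inj₁) (upper-port ∘ inj₂) ↔ Oᴮ
    pullback = mk↔ₛ′ to (λ x → (inj₂ x , x) , refl) (λ _ → refl)
                     λ { ((inj₂ _ , _) , refl) → refl ; ((inj₁ _ , _) , ()) }

  glue-none : ¬ GlueXX Upper Lower
  glue-none ((i , o) , eq) with code-injective {inj₂ (inj₂ i)} {inj₂ (inj₁ o)} eq
  ... | ()

  edges-placed : SE.Classes ↔ (Eᴮ ⊎ (Eᵀ ⊎ GlueOI Upper Lower))
  edges-placed = ↔-refl ⊎-↔ (↔-refl ⊎-↔ glue-cross)

  inputs-placed : (Iᴮ ⊎ Iᵀ) ↔ (Iᴮ ⊎ GlueXI Upper Lower)
  inputs-placed = ↔-refl ⊎-↔ glue-input

  outputs-placed : (Oᴮ ⊎ Oᵀ) ↔ (Oᵀ ⊎ GlueOX Upper Lower)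
  outputs-placed = ↔-trans (⊎-comm _ _) (↔-refl ⊎-↔ glue-output)

  private
    Cm : PreGraph n₁ n₂
    Cm = Upper ∘G Lower
    module Cm = PreGraph Cm

  source-edge : ∀ e b₁ b₂ (p : c (sE e) ≡ b₁) (q : c (tE e) ≡ b₂) →
                SV.side b₁ (sE e , p) ≡
                Cm.s (inj₁ (Inverse.to edges-placed (SE.side₂ b₁ b₂ (e , p , q))))
  source-edge e false false p q = refl
  source-edge e true  true  p q = refl
  source-edge e false true  p q = refl
  source-edge e true  false p q = ⊥-elim (SE.not-true-false e p q)

  target-edge : ∀ e b₁ b₂ (p : c (sE e) ≡ b₁) (q : c (tE e) ≡ b₂) →
                SV.side b₂ (tE e , q) ≡
                Cm.t (inj₁ (Inverse.to edges-placed (SE.side₂ b₁ b₂ (e , p , q))))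
  target-edge e false false p q = refl
  target-edge e true  true  p q = refl
  target-edge e false true  p q = refl
  target-edge e true  false p q = ⊥-elim (SE.not-true-false e p q)

  source-output : ∀ o b (p : c (sO o) ≡ b) →
                  SV.side b (sO o , p) ≡ Cm.s (inj₂ (Inverse.to outputs-placed (SO.side b (o , p))))
  source-output o false p = refl
  source-output o true  p = refl

  target-input : ∀ i b (p : c (tI i) ≡ b) →
                 SV.side b (tI i , p) ≡ Cm.t (inj₂ (Inverse.to inputs-placed (SI.side b (i , p))))
  target-input i false p = refl
  target-input i true  p = refl

  label-input : ∀ i b (p : c (tI i) ≡ b) →
                Cm.α (inj₁ (Inverse.to inputs-placed (SI.side b (i , p)))) ≡ α (inj₁ i)
  label-input i false p = refl
  label-input i true  p = refl

  label-output : ∀ o b (p : c (sO o) ≡ b) →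
                 Cm.β (inj₁ (Inverse.to outputs-placed (SO.side b (o , p)))) ≡ β (inj₁ o)
  label-output o false p = refl
  label-output o true  p = refl

  decomposition : Iso pre (Graph.pre Upper-graph ∘G Graph.pre Lower-graph)
  decomposition = record
    { φV  = SV.split↔
    ; φE  = ↔-trans SE.split₂↔ edges-placed
    ; φI  = ↔-trans SI.split↔ inputs-placed
    ; φO  = ↔-trans SO.split↔ outputs-placed
    ; φIO = empty↔ no-io glue-none
    ; φL  = empty↔ no-loops [ id , id ]
    ; s-comm = λ { (inj₁ e) → source-edge e (c (sE e)) (c (tE e)) refl refl
                 ; (inj₂ o) → source-output o (c (sO o)) refl }
    ; t-comm = λ { (inj₁ e) → target-edge e (c (sE e)) (c (tE e)) refl refl
                 ; (inj₂ i) → target-input i (c (tI i)) refl }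
    ; α-comm = λ { (inj₁ i) → label-input i (c (tI i)) refl ; (inj₂ x) → ⊥-elim (no-io x) }
    ; β-comm = λ { (inj₁ o) → label-output o (c (sO o)) refl ; (inj₂ x) → ⊥-elim (no-io x) }
    }

InLeft InRight : A ⊎ B → Set
InLeft  = [ (λ _ → ⊤) , (λ _ → ⊥) ]
InRight = [ (λ _ → ⊥) , (λ _ → ⊤) ]

one-side-empty : (A → B → ⊥) → A ⊎ B → Empty A ⊎ Empty B
one-side-empty apart (inj₁ a) = inj₂ (apart a)
one-side-empty apart (inj₂ b) = inj₁ (λ a → apart a b)

module _ {n₁ k n₂} (Up : PreGraph k n₂) (Low : PreGraph n₁ k) where

  upper-closed : EdgeClosed (Up ∘G Low) InRight
  upper-closed (inj₁ _)        ()
  upper-closed (inj₂ (inj₁ _)) _ = tt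
  upper-closed (inj₂ (inj₂ _)) ()

  no-path-down : StronglyConnected (Up ∘G Low) → PreGraph.V Up → PreGraph.V Low → ⊥
  no-path-down conn u l = path-preserves InRight upper-closed (conn (inj₂ u) (inj₁ l)) tt

module _ {a b c d n₁ n₂} (p : a + c ≡ n₁) (q : b + d ≡ n₂) (G₁ : PreGraph a b) (G₂ : PreGraph c d)
         (σ : Permutation′ (b + d)) (τ : Permutation′ (a + c)) where

  left-closed : EdgeClosed (castPG p q ((σ ·ˡ (G₁ * G₂)) ·ʳ τ)) InLeft
  left-closed (inj₁ _) _ = tt
  left-closed (inj₂ _) ()

  no-path-across : StronglyConnected (castPG p q ((σ ·ˡ (G₁ * G₂)) ·ʳ τ)) →
                   PreGraph.V G₁ → PreGraph.V G₂ → ⊥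
  no-path-across conn v₁ v₂ = path-preserves InLeft left-closed (conn (inj₁ v₁) (inj₂ v₂)) tt

connected⇒indecomposable : ∀ {ni no} (G : Graph ni no) →
                           ¬ Empty (Graph.V G) → Empty (Graph.IO G) → Empty (Graph.L G) →
                           StronglyConnected (Graph.pre G) → Indecomposable G
connected⇒indecomposable G nonempty no-io no-loops conn = record
  { nonempty = nonempty
  ; no-io    = no-io
  ; loops    = inj₁ no-loops
  ; vert     = λ G₁ G₂ φ → one-side-empty (no-path-down _ _ (connected-iso φ conn))
                                          (Sum.swap (Inverse.to (Iso.φV φ) v))
  ; horiz    = λ p q G₁ G₂ σ τ φ → one-side-empty (no-path-across p q _ _ σ τ (connected-iso φ conn))
                                                  (Inverse.to (Iso.φV φ) v)
  }
  where
  v : Graph.V G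
  v = pick (Graph.finV G) nonempty

indecomposable⇒no-loops : ∀ {ni no} {G : Graph ni no} → Indecomposable G → Empty (Graph.L G)
indecomposable⇒no-loops ind with Indecomposable.loops ind
... | inj₁ no-loops          = no-loops
... | inj₂ (no-vertices , _) = ⊥-elim (Indecomposable.nonempty ind no-vertices)

indecomposable⇒no-cut : ∀ {ni no} (G : Graph ni no) → Indecomposable G →
                        (c : Graph.V G → Bool) → EdgeClosed (Graph.pre G) (λ v → c v ≡ true) →
                        ∀ {x y} → c x ≡ true → c y ≡ false → ⊥
indecomposable⇒no-cut G ind c closed {x} {y} cx cy =
  [ (λ upper-empty → upper-empty (x , cx)) , (λ lower-empty → lower-empty (y , cy)) ]
    (Indecomposable.vert ind D.Upper-graph D.Lower-graph D.decomposition)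
  where
  module D = Decomposition G (Indecomposable.no-io ind) (indecomposable⇒no-loops ind) c closed

indecomposable⇒connected : ∀ {ni no} (G : Graph ni no) → Indecomposable G →
                           StronglyConnected (Graph.pre G)
indecomposable⇒connected G ind x y with reachability (Graph.pre G) (Graph.finV G) (Graph.finE G) x y
... | reachable path           = path
... | separated c closed cx cy = ⊥-elim (indecomposable⇒no-cut G ind c closed cx cy)

proposition3p9 : ∀ {ni no : ℕ} (G : Graph ni no) →
    ¬ Empty (Graph.V G) → Empty (Graph.IO G) →
    Indecomposable G ⇔ (Empty (Graph.L G) × (∀ x y → Path (Graph.pre G) x y))
proposition3p9 G nonempty no-io =
  mk⇔ (λ ind → indecomposable⇒no-loops ind , indecomposable⇒connected G ind)
      (λ (no-loops , conn) → connected⇒indecomposable G nonempty no-io no-loops conn)
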